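{- Let $r$ be a positive integer. If $G$ is a $(2r-2,2r)$-biregular graph, then $\check s(G)\leq r+1$.
   Context: A graph is $(a,b)$-biregular if it is bipartite with a bipartition $(X,Y)$ such that every vertex of $X$ has degree $a$ and every vertex of $Y$ has degree $b$. For a proper edge coloring $\varphi$ of a graph $G$, the palette of a vertex $v$ is the set of colors on edges incident with $v$. The palette index $\check s(G)$ is the minimum number of distinct palettes over all proper edge colorings of $G$. -}

module Defs where

open import Data.Nat using (ℕ; suc; _*_; _∸_)
open import Data.Bool using (Bool; true; false; T; T?)
open import Data.Fin using (Fin)
open import Data.List using (length; filter; allFin)
open import Data.Product using (Σ; ∃; _×_)
open import Relation.Binary.PropositionalEquality using (_≡_; _≢_)
open import Function.Bundles using (_⇔_)

record Graph : Set where
  field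
    n      : ℕ
    adj    : Fin n → Fin n → Bool
    sym    : ∀ u v → adj u v ≡ adj v u
    irrefl : ∀ v → adj v v ≡ false

open Graph public

Adj : (G : Graph) → Fin (n G) → Fin (n G) → Set
Adj G u v = T (adj G u v)

degree : (G : Graph) → Fin (n G) → ℕ
degree G v = length (filter (λ u → T? (adj G v u)) (allFin (n G)))

-- G is (a,b)-biregular: bipartite with bipartition (X,Y) (X = side false,
-- Y = side true), every vertex of X has degree a, every vertex of Y degree b.
IsBiregular : ℕ → ℕ → Graph → Set
IsBiregular a b G =
  Σ (Fin (n G) → Bool) λ side →
    (∀ u v → Adj G u v → side u ≢ side v) ×
    (∀ v → side v ≡ false → degree G v ≡ a) ×
    (∀ v → side v ≡ true → degree G v ≡ b)

IsProperEdgeColouring : (G : Graph) → (Fin (n G) → Fin (n G) → ℕ) → Set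
IsProperEdgeColouring G c =
  (∀ u v → Adj G u v → c u v ≡ c v u) ×
  (∀ v u w → Adj G v u → Adj G v w → u ≢ w → c v u ≢ c v w)

InPalette : (G : Graph) → (Fin (n G) → Fin (n G) → ℕ) → Fin (n G) → ℕ → Set
InPalette G c v x = ∃ λ u → Adj G v u × c v u ≡ x

SamePalette : (G : Graph) → (Fin (n G) → Fin (n G) → ℕ) → Fin (n G) → Fin (n G) → Set
SamePalette G c v w = ∀ x → InPalette G c v x ⇔ InPalette G c w x

-- the colouring c has at most k distinct palettes: the palettes can be
-- labelled by Fin k so that equal labels mean equal palettes
AtMostPalettes : (G : Graph) → (Fin (n G) → Fin (n G) → ℕ) → ℕ → Set
AtMostPalettes G c k =
  Σ (Fin (n G) → Fin k) λ label → ∀ v w → label v ≡ label w → SamePalette G c v w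

PaletteIndex≤ : Graph → ℕ → Set
PaletteIndex≤ G k =
  Σ (Fin (n G) → Fin (n G) → ℕ) λ c → IsProperEdgeColouring G c × AtMostPalettes G c k

-- Let X and Y be the sides of G, of degrees 2r-2 and 2r.  All degrees are even, so by Euler's
-- theorem the edges of G have a balanced orientation O: every vertex is the tail of half of its
-- edges and the head of the other half.  Read the arcs of O as edges of a bipartite graph B
-- between a tail copy and a head copy of V(G), and add a loop (x , x) for each x in X; then B
-- is a simple r-regular bipartite graph, so by König's theorem it has a proper r-edge-colouring
-- κ.  Give the edge of G carried by the arc a the colour 2 κ(a) + [a starts in Y].  At a vertex
-- v the arcs leaving v and those entering v realise, in the two parity classes, every colour of
-- κ except the colour d of the loop at v.  So a vertex of Y sees all colours below 2r, and a
-- vertex of X all of them except 2d and 2d + 1: there are at most r + 1 palettes.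
module Submission where

open import Defs using (Graph; Adj; degree; IsBiregular; InPalette; SamePalette; PaletteIndex≤)

open import Data.Bool using (Bool; true; false; not; _xor_; T; T?)
open import Data.Bool.Properties using () renaming (_≟_ to _≟ᵇ_)
open import Data.Empty using (⊥; ⊥-elim)
open import Data.List using (List; []; _∷_; _++_; length; map; filter; allFin; tabulate; cartesianProduct)
open import Data.List.Membership.Propositional using (_∈_; _∉_)
open import Data.List.Membership.Propositional.Properties
  using (∈-++⁻; ∈-++⁺ˡ; ∈-filter⁻; ∈-filter⁺; ∈-map⁻; ∈-allFin; ∈-cartesianProduct⁺)
open import Data.List.Relation.Binary.Subset.Propositional using (_⊆_)
open import Data.List.Relation.Unary.Any using (here; there)
open import Data.List.Properties using (length-++-sucʳ; length-tabulate)
open import Data.List.Relation.Binary.Pointwise using (Pointwise; []; _∷_; ++⁺)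
open import Data.Fin using (Fin; toℕ; fromℕ<) renaming (zero to fzero; suc to fsuc; _≟_ to _≟ᶠ_)
open import Data.Fin.Properties using (toℕ-fromℕ<) renaming (suc-injective to fsuc-injective)
open import Data.Nat using (ℕ; zero; suc; _+_; _*_; _∸_; _^_; _≤_; _<_; z≤n; s≤s; _<?_)
open import Data.Nat.Properties
open import Data.Nat.DivMod using (_/_; _%_; m≡m%n+[m/n]*n; m%n<n)
open import Data.Nat.Divisibility using (_∣_; divides; ∣-refl; _∣0; ∣1⇒≡1; ∣m+n∣m⇒∣n)
open import Data.Product using (Σ; ∃; _×_; _,_; proj₁; proj₂; swap)
open import Data.Product.Properties using () renaming (≡-dec to ×-≡-dec)
open import Data.Sum using (_⊎_; inj₁; inj₂) renaming (swap to swap⊎)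
open import Function using (_∘_)
open import Function.Bundles using (mk⇔)
open import Relation.Nullary using (Dec; yes; no; ¬_; ¬?; _×-dec_)
open import Relation.Binary.Definitions using (DecidableEquality)
open import Relation.Binary.PropositionalEquality
open import Data.Nat.Tactic.RingSolver using (solve-∀)
open import Algebra.Properties.CommutativeSemigroup +-commutativeSemigroup
  using () renaming (interchange to +-interchange; x∙yz≈y∙xz to +-left-comm)

𝟙 : {P : Set} → Dec P → ℕ
𝟙 (yes _) = 1
𝟙 (no _)  = 0

𝟙-cong : {P Q : Set} (p : Dec P) (q : Dec Q) → (P → Q) → (Q → P) → 𝟙 p ≡ 𝟙 q
𝟙-cong (yes _) (yes _) _ _ = refl
𝟙-cong (yes p) (no ¬q) f _ = ⊥-elim (¬q (f p))
𝟙-cong (no ¬p) (yes q) _ g = ⊥-elim (¬p (g q))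
𝟙-cong (no _)  (no _)  _ _ = refl

𝟙-yes : {P : Set} (p : Dec P) → P → 𝟙 p ≡ 1
𝟙-yes (yes _) _ = refl
𝟙-yes (no ¬p) p = ⊥-elim (¬p p)

𝟙-no : {P : Set} (p : Dec P) → ¬ P → 𝟙 p ≡ 0
𝟙-no (yes p) ¬p = ⊥-elim (¬p p)
𝟙-no (no _)  _  = refl

𝟙≤1 : {P : Set} (p : Dec P) → 𝟙 p ≤ 1
𝟙≤1 (yes _) = ≤-refl
𝟙≤1 (no _)  = z≤n

𝟙*≤ : {P : Set} (p : Dec P) (m : ℕ) → 𝟙 p * m ≤ m
𝟙*≤ (yes _) m = ≤-reflexive (+-identityʳ m)
𝟙*≤ (no _)  m = z≤n

𝟙-pair : {A B : Set} {x a : A} {y b : B} (p : Dec ((x , y) ≡ (a , b))) (p₁ : Dec (x ≡ a)) (p₂ : Dec (y ≡ b)) →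
  𝟙 p ≡ 𝟙 p₁ * 𝟙 p₂
𝟙-pair (yes _)  (yes _)   (yes _)   = refl
𝟙-pair (yes eq) (no x≢a)  _         = ⊥-elim (x≢a (cong proj₁ eq))
𝟙-pair (yes eq) (yes _)   (no y≢b)  = ⊥-elim (y≢b (cong proj₂ eq))
𝟙-pair (no ≢)   (yes refl) (yes refl) = ⊥-elim (≢ refl)
𝟙-pair (no _)   (no _)    _         = refl
𝟙-pair (no _)   (yes _)   (no _)    = refl

∑ : {A : Set} → (A → ℕ) → List A → ℕ
∑ f []       = 0
∑ f (x ∷ xs) = f x + ∑ f xs

module _ {A : Set} where

  ∑-++ : (f : A → ℕ) (xs ys : List A) → ∑ f (xs ++ ys) ≡ ∑ f xs + ∑ f ys
  ∑-++ f []       ys = refl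
  ∑-++ f (x ∷ xs) ys = trans (cong (f x +_) (∑-++ f xs ys)) (sym (+-assoc (f x) _ _))

  ∑-cong : {f g : A → ℕ} (xs : List A) → (∀ x → f x ≡ g x) → ∑ f xs ≡ ∑ g xs
  ∑-cong []       _ = refl
  ∑-cong (x ∷ xs) h = cong₂ _+_ (h x) (∑-cong xs h)

  ∑-+ : (f g : A → ℕ) (xs : List A) → ∑ (λ x → f x + g x) xs ≡ ∑ f xs + ∑ g xs
  ∑-+ f g []       = refl
  ∑-+ f g (x ∷ xs) = trans (cong (f x + g x +_) (∑-+ f g xs)) (+-interchange (f x) (g x) _ _)

  ∑-*ˡ : (c : ℕ) (f : A → ℕ) (xs : List A) → ∑ (λ x → c * f x) xs ≡ c * ∑ f xs
  ∑-*ˡ c f []       = sym (*-zeroʳ c)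
  ∑-*ˡ c f (x ∷ xs) = trans (cong (c * f x +_) (∑-*ˡ c f xs)) (sym (*-distribˡ-+ c (f x) _))

  ∑-zero : (f : A → ℕ) (xs : List A) → (∀ x → f x ≡ 0) → ∑ f xs ≡ 0
  ∑-zero f []       _ = refl
  ∑-zero f (x ∷ xs) h = trans (cong (_+ ∑ f xs) (h x)) (∑-zero f xs h)

  ∑-mono : {f g : A → ℕ} (xs : List A) → (∀ x → f x ≤ g x) → ∑ f xs ≤ ∑ g xs
  ∑-mono []       _ = z≤n
  ∑-mono (x ∷ xs) h = +-mono-≤ (h x) (∑-mono xs h)

  ∈⇒≤∑ : (f : A → ℕ) {xs : List A} {x : A} → x ∈ xs → f x ≤ ∑ f xs
  ∈⇒≤∑ f {y ∷ xs} (here refl) = m≤m+n (f y) _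
  ∈⇒≤∑ f {y ∷ xs} (there x∈) = ≤-trans (∈⇒≤∑ f x∈) (m≤n+m _ (f y))

  ∑≡0⇒≡0 : (f : A → ℕ) {xs : List A} {x : A} → ∑ f xs ≡ 0 → x ∈ xs → f x ≡ 0
  ∑≡0⇒≡0 f {y ∷ xs} s (here refl) = m+n≡0⇒m≡0 (f y) s
  ∑≡0⇒≡0 f {y ∷ xs} s (there x∈) = ∑≡0⇒≡0 f (m+n≡0⇒n≡0 (f y) s) x∈

  ∑-map : {B : Set} (f : B → ℕ) (g : A → B) (xs : List A) → ∑ f (map g xs) ≡ ∑ (f ∘ g) xs
  ∑-map f g []       = refl
  ∑-map f g (x ∷ xs) = cong (f (g x) +_) (∑-map f g xs)

  length-filter : {P : A → Set} (P? : ∀ x → Dec (P x)) (xs : List A) →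
    length (filter P? xs) ≡ ∑ (λ x → 𝟙 (P? x)) xs
  length-filter P? []       = refl
  length-filter P? (x ∷ xs) with P? x
  ... | yes _ = cong suc (length-filter P? xs)
  ... | no _  = length-filter P? xs

  ∑-filter : {P : A → Set} (P? : ∀ x → Dec (P x)) (f : A → ℕ) (xs : List A) →
    ∑ f (filter P? xs) ≡ ∑ (λ x → 𝟙 (P? x) * f x) xs
  ∑-filter P? f []       = refl
  ∑-filter P? f (x ∷ xs) with P? x
  ... | yes _ = cong₂ _+_ (sym (+-identityʳ (f x))) (∑-filter P? f xs)
  ... | no _  = ∑-filter P? f xs

  ∑-insert : (f : A → ℕ) (x y : A) (pre post : List A) →
    ∑ f (x ∷ pre ++ y ∷ post) ≡ (f x + f y) + ∑ f (pre ++ post)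
  ∑-insert f x y pre post = begin
    f x + ∑ f (pre ++ y ∷ post)          ≡⟨ cong (f x +_) (∑-++ f pre (y ∷ post)) ⟩
    f x + (∑ f pre + (f y + ∑ f post))  ≡⟨ regroup (f x) (f y) (∑ f pre) (∑ f post) ⟩
    (f x + f y) + (∑ f pre + ∑ f post)  ≡⟨ cong (f x + f y +_) (sym (∑-++ f pre post)) ⟩
    (f x + f y) + ∑ f (pre ++ post)      ∎
    where
    open ≡-Reasoning
    regroup : ∀ a b c d → a + (c + (b + d)) ≡ (a + b) + (c + d)
    regroup = solve-∀

∑-1 : {A : Set} (xs : List A) → ∑ (λ _ → 1) xs ≡ length xs
∑-1 []       = refl
∑-1 (x ∷ xs) = cong suc (∑-1 xs)

∑-cartesianProduct : {A B : Set} (g : A × B → ℕ) (xs : List A) (ys : List B) →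
  ∑ g (cartesianProduct xs ys) ≡ ∑ (λ x → ∑ (λ y → g (x , y)) ys) xs
∑-cartesianProduct g []       ys = refl
∑-cartesianProduct g (x ∷ xs) ys = begin
  ∑ g (map (x ,_) ys ++ cartesianProduct xs ys)
    ≡⟨ ∑-++ g (map (x ,_) ys) (cartesianProduct xs ys) ⟩
  ∑ g (map (x ,_) ys) + ∑ g (cartesianProduct xs ys)
    ≡⟨ cong₂ _+_ (∑-map g (x ,_) ys) (∑-cartesianProduct g xs ys) ⟩
  ∑ (λ y → g (x , y)) ys + ∑ (λ x → ∑ (λ y → g (x , y)) ys) xs ∎
  where open ≡-Reasoning

module _ {A : Set} {P : A → Set} (P? : ∀ x → Dec (P x)) where

  ∑-remove : (f : A → ℕ) (xs : List A) →
    ∑ f xs ≡ ∑ f (filter (λ x → ¬? (P? x)) xs) + ∑ (λ x → 𝟙 (P? x) * f x) xs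
  ∑-remove f []       = refl
  ∑-remove f (x ∷ xs) with P? x
  ... | yes _ = trans (cong (f x +_) (∑-remove f xs))
                  (regroup (f x) (∑ f (filter (λ x → ¬? (P? x)) xs)) (∑ (λ x → 𝟙 (P? x) * f x) xs))
    where
    regroup : ∀ p q r → p + (q + r) ≡ q + (1 * p + r)
    regroup = solve-∀
  ... | no _  = trans (cong (f x +_) (∑-remove f xs)) (sym (+-assoc (f x) _ _))

  ∑𝟙≡1⇒∃ : ∀ xs → ∑ (λ x → 𝟙 (P? x)) xs ≡ 1 → ∃ λ x → x ∈ xs × P x
  ∑𝟙≡1⇒∃ (x ∷ xs) one with P? x
  ... | yes px = x , here refl , px
  ... | no _   = let (y , y∈ , py) = ∑𝟙≡1⇒∃ xs one in y , there y∈ , py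

  ∑𝟙≡0⇒¬ : ∀ xs {y} → ∑ (λ x → 𝟙 (P? x)) xs ≡ 0 → y ∈ xs → ¬ P y
  ∑𝟙≡0⇒¬ xs {y} none y∈ py = 0≢1 (trans (sym (∑≡0⇒≡0 (λ x → 𝟙 (P? x)) none y∈)) (𝟙-yes (P? y) py))
    where
    0≢1 : 0 ≢ 1
    0≢1 ()

  ∑𝟙≡1⇒unique : ∀ xs → ∑ (λ x → 𝟙 (P? x)) xs ≡ 1 →
    ∀ {y z} → y ∈ xs → P y → z ∈ xs → P z → y ≡ z
  ∑𝟙≡1⇒unique (x ∷ xs) one y∈ py z∈ pz with P? x
  ∑𝟙≡1⇒unique (x ∷ xs) one (here refl) py (here refl) pz | yes _ = refl
  ∑𝟙≡1⇒unique (x ∷ xs) one (here refl) py (there z∈) pz | yes _ =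
    ⊥-elim (∑𝟙≡0⇒¬ xs (suc-injective one) z∈ pz)
  ∑𝟙≡1⇒unique (x ∷ xs) one (there y∈) py z∈ pz | yes _ =
    ⊥-elim (∑𝟙≡0⇒¬ xs (suc-injective one) y∈ py)
  ∑𝟙≡1⇒unique (x ∷ xs) one (here refl) py z∈ pz | no ¬px = ⊥-elim (¬px py)
  ∑𝟙≡1⇒unique (x ∷ xs) one (there y∈) py (here refl) pz | no ¬px = ⊥-elim (¬px pz)
  ∑𝟙≡1⇒unique (x ∷ xs) one (there y∈) py (there z∈) pz | no _ = ∑𝟙≡1⇒unique xs one y∈ py z∈ pz

∑-tabulate : ∀ {B : Set} {n} (f : B → ℕ) (g : Fin n → B) → ∑ f (tabulate g) ≡ ∑ (f ∘ g) (allFin n)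
∑-tabulate {n = zero}  f g = refl
∑-tabulate {n = suc n} f g = cong (f (g fzero) +_)
  (trans (∑-tabulate f (g ∘ fsuc)) (sym (∑-tabulate (f ∘ g) fsuc)))

∑-δ : ∀ {n} (u : Fin n) (g : Fin n → ℕ) → ∑ (λ x → 𝟙 (x ≟ᶠ u) * g x) (allFin n) ≡ g u
∑-δ {suc n} fzero g = begin
  g fzero + 0 + ∑ (λ x → 𝟙 (x ≟ᶠ fzero) * g x) (tabulate fsuc)
    ≡⟨ cong₂ _+_ (+-identityʳ (g fzero)) (∑-tabulate (λ x → 𝟙 (x ≟ᶠ fzero) * g x) fsuc) ⟩
  g fzero + ∑ (λ x → 0) (allFin n)
    ≡⟨ cong (g fzero +_) (∑-zero (λ _ → 0) (allFin n) (λ _ → refl)) ⟩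
  g fzero + 0
    ≡⟨ +-identityʳ (g fzero) ⟩
  g fzero ∎
  where open ≡-Reasoning
∑-δ {suc n} (fsuc u) g = begin
  ∑ (λ x → 𝟙 (x ≟ᶠ fsuc u) * g x) (tabulate fsuc)
    ≡⟨ ∑-tabulate (λ x → 𝟙 (x ≟ᶠ fsuc u) * g x) fsuc ⟩
  ∑ (λ x → 𝟙 (fsuc x ≟ᶠ fsuc u) * g (fsuc x)) (allFin n)
    ≡⟨ ∑-cong (allFin n) (λ x → cong (_* g (fsuc x)) (𝟙-cong (fsuc x ≟ᶠ fsuc u) (x ≟ᶠ u) fsuc-injective (cong fsuc))) ⟩
  ∑ (λ x → 𝟙 (x ≟ᶠ u) * g (fsuc x)) (allFin n)
    ≡⟨ ∑-δ u (g ∘ fsuc) ⟩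
  g (fsuc u) ∎
  where open ≡-Reasoning

∑-δ-row : ∀ {n} {B : Set} (u : Fin n) (h : Fin n → B → ℕ) (ys : List B) →
  ∑ (λ x → ∑ (λ y → 𝟙 (x ≟ᶠ u) * h x y) ys) (allFin n) ≡ ∑ (h u) ys
∑-δ-row u h ys = trans (∑-cong (allFin _) (λ x → ∑-*ˡ (𝟙 (x ≟ᶠ u)) (h x) ys)) (∑-δ u (λ x → ∑ (h x) ys))

copies : {A : Set} → ℕ → List A → List A
copies zero    xs = []
copies (suc k) xs = xs ++ copies k xs

∑-copies : {A : Set} (f : A → ℕ) (k : ℕ) (xs : List A) → ∑ f (copies k xs) ≡ k * ∑ f xs
∑-copies f zero    xs = refl
∑-copies f (suc k) xs = trans (∑-++ f xs (copies k xs)) (cong (∑ f xs +_) (∑-copies f k xs))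

∈-copies : {A : Set} (k : ℕ) (xs : List A) {x : A} → x ∈ copies k xs → x ∈ xs
∈-copies (suc k) xs x∈ with ∈-++⁻ xs x∈
... | inj₁ x∈xs = x∈xs
... | inj₂ x∈copies = ∈-copies k xs x∈copies

Pointwise-++⁻ : {A B : Set} {R : A → B → Set} (xs ys : List A) {zs : List B} →
  Pointwise R (xs ++ ys) zs →
  Σ (List B) λ zs₁ → Σ (List B) λ zs₂ → zs ≡ zs₁ ++ zs₂ × Pointwise R xs zs₁ × Pointwise R ys zs₂
Pointwise-++⁻ []       ys rs       = [] , _ , refl , [] , rs
Pointwise-++⁻ (x ∷ xs) ys (r ∷ rs) with Pointwise-++⁻ xs ys rs
... | zs₁ , zs₂ , refl , rs₁ , rs₂ = _ ∷ zs₁ , zs₂ , refl , r ∷ rs₁ , rs₂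

Pointwise-∈ˡ : {A B : Set} {R : A → B → Set} {xs : List A} {ys : List B} {x : A} →
  x ∈ xs → Pointwise R xs ys → ∃ λ y → y ∈ ys × R x y
Pointwise-∈ˡ (here refl) (r ∷ _)  = _ , here refl , r
Pointwise-∈ˡ (there x∈) (_ ∷ rs) = let (y , y∈ , r) = Pointwise-∈ˡ x∈ rs in y , there y∈ , r

Pointwise-∈ʳ : {A B : Set} {R : A → B → Set} {xs : List A} {ys : List B} {y : B} →
  y ∈ ys → Pointwise R xs ys → ∃ λ x → x ∈ xs × R x y
Pointwise-∈ʳ (here refl) (r ∷ _)  = _ , here refl , r
Pointwise-∈ʳ (there y∈) (_ ∷ rs) = let (x , x∈ , r) = Pointwise-∈ʳ y∈ rs in x , there x∈ , r

bit : Bool → ℕ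
bit false = 0
bit true  = 1

xor-cancelʳ : ∀ b c → (b xor c) xor c ≡ b
xor-cancelʳ false false = refl
xor-cancelʳ false true  = refl
xor-cancelʳ true  false = refl
xor-cancelʳ true  true  = refl

2*+bit-injective : ∀ i j b c → 2 * i + bit b ≡ 2 * j + bit c → i ≡ j × b ≡ c
2*+bit-injective i j false false eq =
  *-cancelˡ-≡ i j 2 (trans (sym (+-identityʳ _)) (trans eq (+-identityʳ _))) , refl
2*+bit-injective i j true  true  eq =
  *-cancelˡ-≡ i j 2 (+-cancelʳ-≡ 1 (2 * i) (2 * j) eq) , refl
2*+bit-injective i j false true  eq = ⊥-elim (even≢odd i j (trans (sym (+-identityʳ _)) (trans eq (+-comm _ 1))))
2*+bit-injective i j true  false eq = ⊥-elim (even≢odd j i (trans (sym (+-identityʳ _)) (trans (sym eq) (+-comm _ 1))))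

2∤1 : ¬ 2 ∣ 1
2∤1 2∣1 with ∣1⇒≡1 2∣1
... | ()

2∣m+m : ∀ m → 2 ∣ m + m
2∣m+m m = divides m (m+m≡m*2 m)
  where
  m+m≡m*2 : ∀ m → m + m ≡ m * 2
  m+m≡m*2 = solve-∀

+-double≤1 : ∀ m → m + m ≤ 1 → m ≡ 0
+-double≤1 zero    _         = refl
+-double≤1 (suc m) (s≤s m+1+m≤0) with subst (_≤ 0) (+-suc m m) m+1+m≤0
... | ()

+-double-injective : ∀ m n → m + m ≡ n + n → m ≡ n
+-double-injective m n eq = *-cancelˡ-≡ m n 2 (trans (twice m) (trans eq (sym (twice n))))
  where
  twice : ∀ m → 2 * m ≡ m + m
  twice = solve-∀

m<2^m : ∀ m → m < 2 ^ m
m<2^m zero    = s≤s z≤n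
m<2^m (suc m) = subst₂ _≤_ (+-comm (suc m) 1) (cong (2 ^ m +_) (sym (+-identityʳ (2 ^ m))))
  (+-mono-≤ (m<2^m m) (m^n>0 2 m))

-- Balanced orientations.  An edge list E of a multigraph on V is a list of arcs; reorienting
-- some of them gives an orientation O of E.
module Orientation {V : Set} (_≟_ : DecidableEquality V) where

  Arc : Set
  Arc = V × V

  -- how often u is the tail, the head, an endpoint of an arc (a loop counts twice)
  tailAt headAt endAt : V → Arc → ℕ
  tailAt u e = 𝟙 (proj₁ e ≟ u)
  headAt u e = 𝟙 (proj₂ e ≟ u)
  endAt  u e = tailAt u e + headAt u e

  _⇝_ : Arc → Arc → Set
  p ⇝ q = q ≡ p ⊎ q ≡ swap p

  ⇝-sym : {p q : Arc} → p ⇝ q → q ⇝ p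
  ⇝-sym (inj₁ refl) = inj₁ refl
  ⇝-sym (inj₂ refl) = inj₂ refl

  ⇝-swap : {p q : Arc} → p ⇝ q → q ⇝ swap p
  ⇝-swap (inj₁ refl) = inj₂ refl
  ⇝-swap (inj₂ refl) = inj₁ refl

  Balanced : List Arc → Set
  Balanced O = ∀ u → ∑ (tailAt u) O ≡ ∑ (headAt u) O

  BalancedOrientation : List Arc → Set
  BalancedOrientation E = Σ (List Arc) λ O → Pointwise _⇝_ E O × Balanced O

  EvenDegrees : List Arc → Set
  EvenDegrees E = ∀ u → 2 ∣ ∑ (endAt u) E

  ∑-reorient : (g : Arc → ℕ) → (∀ p → g (swap p) ≡ g p) →
    {E O : List Arc} → Pointwise _⇝_ E O → ∑ g O ≡ ∑ g E
  ∑-reorient g inv []                = refl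
  ∑-reorient g inv (inj₁ refl ∷ ps) = cong (g _ +_) (∑-reorient g inv ps)
  ∑-reorient g inv (inj₂ refl ∷ ps) = cong₂ _+_ (inv _) (∑-reorient g inv ps)

  endAt-swap : ∀ u p → endAt u (swap p) ≡ endAt u p
  endAt-swap u p = +-comm (headAt u p) (tailAt u p)

  endAt-⇝ : ∀ u {p q} → p ⇝ q → endAt u q ≡ endAt u p
  endAt-⇝ u (inj₁ refl) = refl
  endAt-⇝ u (inj₂ refl) = endAt-swap u _

  loop-even : ∀ u v → 2 ∣ endAt u (v , v)
  loop-even u v with v ≟ u
  ... | yes _ = ∣-refl
  ... | no _  = 2 ∣0

  Through : V → Arc → Set
  Through v e = Σ V λ b → (v , b) ⇝ e

  arcThrough : (v : V) (E : List Arc) →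
    (Σ (List Arc) λ pre → Σ Arc λ e → Σ (List Arc) λ post → E ≡ pre ++ e ∷ post × Through v e)
    ⊎ ∑ (endAt v) E ≡ 0
  arcThrough v []             = inj₂ refl
  arcThrough v ((a , b) ∷ E) with a ≟ v | b ≟ v
  ... | yes refl | _        = inj₁ ([] , _ , E , refl , b , inj₁ refl)
  ... | no _     | yes refl = inj₁ ([] , _ , E , refl , a , inj₂ refl)
  ... | no _     | no _ with arcThrough v E
  ...   | inj₂ deg0 = inj₂ deg0
  ...   | inj₁ (pre , e , post , refl , t) = inj₁ ((a , b) ∷ pre , e , post , refl , t)

  -- Replacing the arc av and an arc e through v (an orientation of vb) by the single arc ab
  -- changes each degree by the contribution of a loop at v.
  ∑-shortcut : ∀ u {a v b e} pre post → (v , b) ⇝ e →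
    ∑ (endAt u) ((a , v) ∷ pre ++ e ∷ post) ≡ endAt u (v , v) + ∑ (endAt u) ((a , b) ∷ pre ++ post)
  ∑-shortcut u {a} {v} {b} {e} pre post vb⇝e = begin
    ∑ (endAt u) ((a , v) ∷ pre ++ e ∷ post)
      ≡⟨ ∑-insert (endAt u) (a , v) e pre post ⟩
    (endAt u (a , v) + endAt u e) + S
      ≡⟨ cong (λ d → (endAt u (a , v) + d) + S) (endAt-⇝ u vb⇝e) ⟩
    (endAt u (a , v) + endAt u (v , b)) + S
      ≡⟨ regroup (𝟙 (a ≟ u)) (𝟙 (v ≟ u)) (𝟙 (b ≟ u)) S ⟩
    endAt u (v , v) + (endAt u (a , b) + S) ∎
    where
    open ≡-Reasoning
    S : ℕ
    S = ∑ (endAt u) (pre ++ post)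
    regroup : ∀ x y z s → ((x + y) + (y + z)) + s ≡ (y + y) + ((x + z) + s)
    regroup = solve-∀

  -- Conversely, splitting an arc z into two arcs x, y through v keeps an orientation balanced.
  balanced-split : ∀ v (x y z : Arc) zs₁ zs₂ →
    (∀ u → tailAt u x + tailAt u y ≡ tailAt u z + 𝟙 (v ≟ u)) →
    (∀ u → headAt u x + headAt u y ≡ headAt u z + 𝟙 (v ≟ u)) →
    Balanced (z ∷ zs₁ ++ zs₂) → Balanced (x ∷ zs₁ ++ y ∷ zs₂)
  balanced-split v x y z zs₁ zs₂ tails heads bal u = begin
    ∑ (tailAt u) (x ∷ zs₁ ++ y ∷ zs₂)       ≡⟨ ∑-insert (tailAt u) x y zs₁ zs₂ ⟩
    (tailAt u x + tailAt u y) + St          ≡⟨ cong (_+ St) (tails u) ⟩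
    (tailAt u z + 𝟙 (v ≟ u)) + St           ≡⟨ +-right-comm (tailAt u z) (𝟙 (v ≟ u)) St ⟩
    (tailAt u z + St) + 𝟙 (v ≟ u)           ≡⟨ cong (_+ 𝟙 (v ≟ u)) (bal u) ⟩
    (headAt u z + Sh) + 𝟙 (v ≟ u)           ≡⟨ +-right-comm (headAt u z) Sh (𝟙 (v ≟ u)) ⟩
    (headAt u z + 𝟙 (v ≟ u)) + Sh           ≡⟨ cong (_+ Sh) (sym (heads u)) ⟩
    (headAt u x + headAt u y) + Sh          ≡⟨ sym (∑-insert (headAt u) x y zs₁ zs₂) ⟩
    ∑ (headAt u) (x ∷ zs₁ ++ y ∷ zs₂)       ∎
    where
    open ≡-Reasoning
    St Sh : ℕ
    St = ∑ (tailAt u) (zs₁ ++ zs₂)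
    Sh = ∑ (headAt u) (zs₁ ++ zs₂)
    +-right-comm : ∀ p q r → (p + q) + r ≡ (p + r) + q
    +-right-comm = solve-∀

  unshortcut : ∀ {a v b e} pre post → (v , b) ⇝ e →
    BalancedOrientation ((a , b) ∷ pre ++ post) → BalancedOrientation ((a , v) ∷ pre ++ e ∷ post)
  unshortcut {a} {v} {b} pre post vb⇝e (o ∷ O , o⇝ ∷ ps , bal)
    with Pointwise-++⁻ pre post ps
  ... | zs₁ , zs₂ , refl , ps₁ , ps₂ with o⇝
  ...   | inj₁ refl =
          (a , v) ∷ zs₁ ++ (v , b) ∷ zs₂ , inj₁ refl ∷ ++⁺ ps₁ (⇝-sym vb⇝e ∷ ps₂) ,
          balanced-split v (a , v) (v , b) (a , b) zs₁ zs₂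
            (λ u → refl) (λ u → +-comm (𝟙 (v ≟ u)) (𝟙 (b ≟ u))) bal
  ...   | inj₂ refl =
          (v , a) ∷ zs₁ ++ (b , v) ∷ zs₂ , inj₂ refl ∷ ++⁺ ps₁ (⇝-swap vb⇝e ∷ ps₂) ,
          balanced-split v (v , a) (b , v) (b , a) zs₁ zs₂
            (λ u → +-comm (𝟙 (v ≟ u)) (𝟙 (b ≟ u))) (λ u → refl) bal

  -- Euler's theorem, by induction on the number of arcs (given as fuel k): remove a loop, or
  -- shortcut the first arc av with another arc through v, which exists as v has even degree.
  euler-fuel : ∀ k E → length E ≤ k → EvenDegrees E → BalancedOrientation E
  euler-fuel k       []            _           _    = [] , [] , λ u → refl
  euler-fuel (suc k) ((a , v) ∷ E) (s≤s |E|≤k) even with a ≟ v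
  ... | yes refl =
        let (O , ps , bal) = euler-fuel k E |E|≤k (λ u → ∣m+n∣m⇒∣n (even u) (loop-even u v))
        in (v , v) ∷ O , inj₁ refl ∷ ps , λ u → cong (𝟙 (v ≟ u) +_) (bal u)
  ... | no a≢v with arcThrough v E
  ...   | inj₂ deg0 = ⊥-elim (2∤1 (subst (2 ∣_) (cong₂ _+_ (endAt-in a≢v) deg0) (even v)))
    where
    endAt-in : a ≢ v → endAt v (a , v) ≡ 1
    endAt-in a≢v rewrite 𝟙-no (a ≟ v) a≢v | 𝟙-yes (v ≟ v) refl = refl
  ...   | inj₁ (pre , e , post , refl , b , vb⇝e) =
          unshortcut pre post vb⇝e (euler-fuel k ((a , b) ∷ pre ++ post) shorter evenShortcut)
    where
    shorter : suc (length (pre ++ post)) ≤ k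
    shorter = subst (_≤ k) (length-++-sucʳ pre e post) |E|≤k
    evenShortcut : EvenDegrees ((a , b) ∷ pre ++ post)
    evenShortcut u = ∣m+n∣m⇒∣n (subst (2 ∣_) (∑-shortcut u pre post vb⇝e) (even u)) (loop-even u v)

  euler : ∀ E → EvenDegrees E → BalancedOrientation E
  euler E = euler-fuel (length E) E ≤-refl

-- Bipartite multigraphs between two copies of Fin n.  Edges have an arbitrary type A; the
-- s-end of an edge is its left end for s = false and its right end for s = true.
module Bipartite {A : Set} {n : ℕ} (end : Bool → A → Fin n) where

  degAt : Bool → Fin n → A → ℕ
  degAt s v a = 𝟙 (end s a ≟ᶠ v)

  Regular : ℕ → List A → Set
  Regular d F = ∀ s v → ∑ (degAt s v) F ≡ d

  record Halving (m : ℕ) (F : List A) : Set where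
    field
      K L      : List A
      K⊆F      : K ⊆ F
      L⊆F      : L ⊆ F
      ∑-halves : ∀ f → ∑ f F ≡ ∑ f K + ∑ f L
      K-regular : Regular m K
      L-regular : Regular m L

  -- The split comes from a balanced orientation of F, seen as a multigraph on the vertex set
  -- Bool × Fin n: K consists of the edges oriented left to right, L of the others.
  module _ where
    _≟ₙ_ : DecidableEquality (Bool × Fin n)
    _≟ₙ_ = ×-≡-dec _≟ᵇ_ _≟ᶠ_

    open Orientation _≟ₙ_

    toArc : A → Arc
    toArc a = (false , end false a) , (true , end true a)

    node-δ : ∀ s v a → 𝟙 ((s , end s a) ≟ₙ (s , v)) ≡ degAt s v a
    node-δ s v a = 𝟙-cong ((s , end s a) ≟ₙ (s , v)) (end s a ≟ᶠ v) (cong proj₂) (cong (s ,_))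

    endAt-toArc : ∀ s v a → endAt (s , v) (toArc a) ≡ degAt s v a
    endAt-toArc false v a = trans (+-identityʳ _) (node-δ false v a)
    endAt-toArc true  v a = node-δ true v a

    keptReversed : ∀ F {O} → Pointwise _⇝_ (map toArc F) O → List A × List A
    keptReversed []      []                = [] , []
    keptReversed (a ∷ F) (inj₁ _ ∷ ps) = a ∷ proj₁ (keptReversed F ps) , proj₂ (keptReversed F ps)
    keptReversed (a ∷ F) (inj₂ _ ∷ ps) = proj₁ (keptReversed F ps) , a ∷ proj₂ (keptReversed F ps)

    ∑-keptReversed : (f : A → ℕ) → ∀ F {O} (ps : Pointwise _⇝_ (map toArc F) O) →
      ∑ f F ≡ ∑ f (proj₁ (keptReversed F ps)) + ∑ f (proj₂ (keptReversed F ps))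
    ∑-keptReversed f []      []                = refl
    ∑-keptReversed f (a ∷ F) (inj₁ _ ∷ ps) =
      trans (cong (f a +_) (∑-keptReversed f F ps)) (sym (+-assoc (f a) _ _))
    ∑-keptReversed f (a ∷ F) (inj₂ _ ∷ ps) =
      trans (cong (f a +_) (∑-keptReversed f F ps))
        (+-left-comm (f a) (∑ f (proj₁ (keptReversed F ps))) (∑ f (proj₂ (keptReversed F ps))))

    ∑-orientation : (g : Arc → ℕ) → ∀ F {O} (ps : Pointwise _⇝_ (map toArc F) O) →
      ∑ g O ≡ ∑ (g ∘ toArc) (proj₁ (keptReversed F ps)) + ∑ (g ∘ swap ∘ toArc) (proj₂ (keptReversed F ps))
    ∑-orientation g []      []                = refl
    ∑-orientation g (a ∷ F) (inj₁ refl ∷ ps) =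
      trans (cong (g (toArc a) +_) (∑-orientation g F ps)) (sym (+-assoc (g (toArc a)) _ _))
    ∑-orientation g (a ∷ F) (inj₂ refl ∷ ps) =
      trans (cong (g (swap (toArc a)) +_) (∑-orientation g F ps))
        (+-left-comm (g (swap (toArc a))) (∑ (g ∘ toArc) (proj₁ (keptReversed F ps)))
          (∑ (g ∘ swap ∘ toArc) (proj₂ (keptReversed F ps))))

    kept⊆ : ∀ F {O} (ps : Pointwise _⇝_ (map toArc F) O) → proj₁ (keptReversed F ps) ⊆ F
    kept⊆ []      []            ()
    kept⊆ (a ∷ F) (inj₁ _ ∷ ps) (here refl) = here refl
    kept⊆ (a ∷ F) (inj₁ _ ∷ ps) (there x∈) = there (kept⊆ F ps x∈)
    kept⊆ (a ∷ F) (inj₂ _ ∷ ps) x∈         = there (kept⊆ F ps x∈)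

    reversed⊆ : ∀ F {O} (ps : Pointwise _⇝_ (map toArc F) O) → proj₂ (keptReversed F ps) ⊆ F
    reversed⊆ []      []            ()
    reversed⊆ (a ∷ F) (inj₂ _ ∷ ps) (here refl) = here refl
    reversed⊆ (a ∷ F) (inj₂ _ ∷ ps) (there x∈) = there (reversed⊆ F ps x∈)
    reversed⊆ (a ∷ F) (inj₁ _ ∷ ps) x∈         = there (reversed⊆ F ps x∈)

    ∑-kept : ∀ F {O} (ps : Pointwise _⇝_ (map toArc F) O) (g : Arc → ℕ) (f : A → ℕ) →
      (∀ a → g (toArc a) ≡ f a) → (∀ a → g (swap (toArc a)) ≡ 0) →
      ∑ g O ≡ ∑ f (proj₁ (keptReversed F ps))
    ∑-kept F {O} ps g f onK offL = begin
      ∑ g O                                      ≡⟨ ∑-orientation g F ps ⟩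
      ∑ (g ∘ toArc) K + ∑ (g ∘ swap ∘ toArc) L  ≡⟨ cong₂ _+_ (∑-cong K onK) (∑-zero _ L offL) ⟩
      ∑ f K + 0                                  ≡⟨ +-identityʳ _ ⟩
      ∑ f K                                      ∎
      where
      open ≡-Reasoning
      K L : List A
      K = proj₁ (keptReversed F ps)
      L = proj₂ (keptReversed F ps)

    ∑-reversed : ∀ F {O} (ps : Pointwise _⇝_ (map toArc F) O) (g : Arc → ℕ) (f : A → ℕ) →
      (∀ a → g (toArc a) ≡ 0) → (∀ a → g (swap (toArc a)) ≡ f a) →
      ∑ g O ≡ ∑ f (proj₂ (keptReversed F ps))
    ∑-reversed F ps g f offK onL =
      trans (∑-orientation g F ps) (cong₂ _+_ (∑-zero _ (proj₁ (keptReversed F ps)) offK)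
        (∑-cong {f = g ∘ swap ∘ toArc} (proj₂ (keptReversed F ps)) onL))

    -- balance at the node (s , v) says that v is an s-end equally often in K and in L
    kept≡reversed : ∀ F {O} (ps : Pointwise _⇝_ (map toArc F) O) → Balanced O →
      ∀ s v → ∑ (degAt s v) (proj₁ (keptReversed F ps)) ≡ ∑ (degAt s v) (proj₂ (keptReversed F ps))
    kept≡reversed F {O} ps bal false v = begin
      ∑ (degAt false v) (proj₁ (keptReversed F ps))
        ≡⟨ sym (∑-kept F ps (tailAt (false , v)) (degAt false v) (node-δ false v) (λ _ → refl)) ⟩
      ∑ (tailAt (false , v)) O
        ≡⟨ bal (false , v) ⟩
      ∑ (headAt (false , v)) O
        ≡⟨ ∑-reversed F ps (headAt (false , v)) (degAt false v) (λ _ → refl) (node-δ false v) ⟩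
      ∑ (degAt false v) (proj₂ (keptReversed F ps)) ∎
      where open ≡-Reasoning
    kept≡reversed F {O} ps bal true v = begin
      ∑ (degAt true v) (proj₁ (keptReversed F ps))
        ≡⟨ sym (∑-kept F ps (headAt (true , v)) (degAt true v) (node-δ true v) (λ _ → refl)) ⟩
      ∑ (headAt (true , v)) O
        ≡⟨ sym (bal (true , v)) ⟩
      ∑ (tailAt (true , v)) O
        ≡⟨ ∑-reversed F ps (tailAt (true , v)) (degAt true v) (λ _ → refl) (node-δ true v) ⟩
      ∑ (degAt true v) (proj₂ (keptReversed F ps)) ∎
      where open ≡-Reasoning

    halving : ∀ m F → Regular (m + m) F → Halving m F
    halving m F reg = record
      { K = K ; L = L ; K⊆F = kept⊆ F ps ; L⊆F = reversed⊆ F ps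
      ; ∑-halves = λ f → ∑-keptReversed f F ps
      ; K-regular = λ s v → half s v
      ; L-regular = λ s v → trans (sym (kept≡reversed F ps bal s v)) (half s v) }
      where
      even : EvenDegrees (map toArc F)
      even (s , v) = subst (2 ∣_) (sym deg-sv) (2∣m+m m)
        where
        deg-sv : ∑ (endAt (s , v)) (map toArc F) ≡ m + m
        deg-sv = trans (∑-map (endAt (s , v)) toArc F) (trans (∑-cong F (endAt-toArc s v)) (reg s v))
      orientation : BalancedOrientation (map toArc F)
      orientation = euler (map toArc F) even
      ps : Pointwise _⇝_ (map toArc F) (proj₁ orientation)
      ps = proj₁ (proj₂ orientation)
      bal : Balanced (proj₁ orientation)
      bal = proj₂ (proj₂ orientation)
      K L : List A
      K = proj₁ (keptReversed F ps)
      L = proj₂ (keptReversed F ps)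
      half : ∀ s v → ∑ (degAt s v) K ≡ m
      half s v = +-double-injective _ m (begin
        ∑ (degAt s v) K + ∑ (degAt s v) K ≡⟨ cong (∑ (degAt s v) K +_) (kept≡reversed F ps bal s v) ⟩
        ∑ (degAt s v) K + ∑ (degAt s v) L ≡⟨ sym (∑-keptReversed (degAt s v) F ps) ⟩
        ∑ (degAt s v) F                   ≡⟨ reg s v ⟩
        m + m                             ∎)
        where open ≡-Reasoning

  -- Every 2^s-regular F with fewer than 2^s bad edges contains a perfect matching (a 1-regular
  -- sub-list) avoiding them: halve F and recurse into the half with fewer bad edges.
  matchingAvoiding : ∀ s F → Regular (2 ^ s) F → (bad : A → ℕ) → ∑ bad F < 2 ^ s →
    Σ (List A) λ M → M ⊆ F × Regular 1 M × ∑ bad M ≡ 0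
  matchingAvoiding zero    F reg bad few = F , (λ x∈ → x∈) , reg , n<1⇒n≡0 few
  matchingAvoiding (suc s) F reg bad few = recurse (halving (2 ^ s) F reg′)
    where
    2^suc : 2 ^ suc s ≡ 2 ^ s + 2 ^ s
    2^suc = cong (2 ^ s +_) (+-identityʳ (2 ^ s))
    reg′ : Regular (2 ^ s + 2 ^ s) F
    reg′ = subst (λ d → Regular d F) 2^suc reg
    recurse : Halving (2 ^ s) F → Σ (List A) λ M → M ⊆ F × Regular 1 M × ∑ bad M ≡ 0
    recurse h = pick (∑ bad K <? 2 ^ s)
      where
      open Halving h
      pick : Dec (∑ bad K < 2 ^ s) → Σ (List A) λ M → M ⊆ F × Regular 1 M × ∑ bad M ≡ 0
      pick (yes fewK) =
        let (M , M⊆K , regM , badM) = matchingAvoiding s K K-regular bad fewK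
        in M , (λ x∈ → K⊆F (M⊆K x∈)) , regM , badM
      pick (no manyK) =
        let (M , M⊆L , regM , badM) = matchingAvoiding s L L-regular bad fewL
        in M , (λ x∈ → L⊆F (M⊆L x∈)) , regM , badM
        where
        fewL : ∑ bad L < 2 ^ s
        fewL = +-cancelˡ-< (2 ^ s) _ _ (≤-<-trans (+-monoˡ-≤ (∑ bad L) (≮⇒≥ manyK))
                 (subst₂ _<_ (∑-halves bad) 2^suc few))

-- König's theorem for simple regular bipartite graphs whose two sides are copies of Fin n;
-- an edge is a pair (left end , right end).
module König (n : ℕ) where

  Pair : Set
  Pair = Fin n × Fin n

  _≟ₚ_ : DecidableEquality Pair
  _≟ₚ_ = ×-≡-dec _≟ᶠ_ _≟ᶠ_

  open import Data.List.Membership.DecPropositional _≟ₚ_ using (_∈?_)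

  end : Bool → Pair → Fin n
  end false = proj₁
  end true  = proj₂

  open Bipartite end public using (degAt; Regular)

  end-diagonal : ∀ s x → end s (x , x) ≡ x
  end-diagonal false x = refl
  end-diagonal true  x = refl

  -- With r = k + 1 and t = r n write 2^t = α r + β (β < r).  For a (k+1)-regular E,
  -- α copies of E (tagged false) plus β copies of the n dummy loops (v , v) (tagged true) form
  -- a 2^t-regular multigraph F with β n < 2^t dummy edges; so F has a perfect matching that
  -- avoids the dummy edges, and this is a perfect matching of E.
  module Padding (k : ℕ) (E : List Pair) (reg : Regular (suc k) E) where
    module Tagged = Bipartite {A = Bool × Pair} (λ s → end s ∘ proj₂)
    r t α β : ℕ
    r = suc k
    t = r * n
    α = 2 ^ t / r
    β = 2 ^ t % r
    real dummy F : List (Bool × Pair)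
    real  = map (false ,_) E
    dummy = map (λ v → true , v , v) (allFin n)
    F     = copies α real ++ copies β dummy

    ∑-F : ∀ f → ∑ f F ≡ α * ∑ f real + β * ∑ f dummy
    ∑-F f = trans (∑-++ f (copies α real) (copies β dummy)) (cong₂ _+_ (∑-copies f α real) (∑-copies f β dummy))

    ∑-dummy : ∀ s v → ∑ (Tagged.degAt s v) dummy ≡ 1
    ∑-dummy s v = begin
      ∑ (Tagged.degAt s v) dummy        ≡⟨ ∑-map (Tagged.degAt s v) _ (allFin n) ⟩
      ∑ (λ x → 𝟙 (end s (x , x) ≟ᶠ v)) (allFin n)
        ≡⟨ ∑-cong (allFin n) (λ x → trans (cong (λ y → 𝟙 (y ≟ᶠ v)) (end-diagonal s x)) (sym (*-identityʳ _))) ⟩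
      ∑ (λ x → 𝟙 (x ≟ᶠ v) * 1) (allFin n) ≡⟨ ∑-δ v (λ _ → 1) ⟩
      1                                  ∎
      where open ≡-Reasoning

    regF : Tagged.Regular (2 ^ t) F
    regF s v = begin
      ∑ (Tagged.degAt s v) F                                    ≡⟨ ∑-F (Tagged.degAt s v) ⟩
      α * ∑ (Tagged.degAt s v) real + β * ∑ (Tagged.degAt s v) dummy
        ≡⟨ cong₂ (λ a b → α * a + β * b) (trans (∑-map (Tagged.degAt s v) _ E) (reg s v)) (∑-dummy s v) ⟩
      α * r + β * 1                                             ≡⟨ cong (α * r +_) (*-identityʳ β) ⟩
      α * r + β                                                 ≡⟨ +-comm (α * r) β ⟩
      β + α * r                                                 ≡⟨ sym (m≡m%n+[m/n]*n (2 ^ t) r) ⟩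
      2 ^ t                                                     ∎
      where open ≡-Reasoning

    isDummy : Bool × Pair → ℕ
    isDummy = bit ∘ proj₁

    fewDummies : ∑ isDummy F < 2 ^ t
    fewDummies = begin-strict
      ∑ isDummy F                            ≡⟨ ∑-F isDummy ⟩
      α * ∑ isDummy real + β * ∑ isDummy dummy
        ≡⟨ cong₂ (λ a b → α * a + β * b) (trans (∑-map isDummy _ E) (∑-zero _ E (λ _ → refl)))
                 (trans (∑-map isDummy _ (allFin n)) (trans (∑-1 (allFin n)) (length-tabulate {n = n} (λ x → x)))) ⟩
      α * 0 + β * n                          ≡⟨ cong (_+ β * n) (*-zeroʳ α) ⟩
      β * n                                  ≤⟨ *-monoˡ-≤ n (<⇒≤ (m%n<n (2 ^ t) r)) ⟩
      t                                      <⟨ m<2^m t ⟩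
      2 ^ t                                  ∎
      where open ≤-Reasoning

    matching : Σ (List (Bool × Pair)) λ M → M ⊆ F × Tagged.Regular 1 M × ∑ isDummy M ≡ 0
    matching = Tagged.matchingAvoiding t F regF isDummy fewDummies

    real∈E : ∀ {x} → x ∈ F → isDummy x ≡ 0 → proj₂ x ∈ E
    real∈E x∈F notDummy with ∈-++⁻ (copies α real) x∈F
    ... | inj₁ x∈real with ∈-map⁻ (false ,_) (∈-copies α real x∈real)
    ...   | e , e∈E , refl = e∈E
    real∈E x∈F notDummy | inj₂ x∈dummy with ∈-map⁻ _ (∈-copies β dummy x∈dummy)
    ...   | _ , _ , refl with notDummy
    ...     | ()

    matchingOfE : Σ (List Pair) λ M → M ⊆ E × Regular 1 M
    matchingOfE = forgetTags matching
      where
      forgetTags : Σ (List (Bool × Pair)) (λ M → M ⊆ F × Tagged.Regular 1 M × ∑ isDummy M ≡ 0) →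
        Σ (List Pair) λ M → M ⊆ E × Regular 1 M
      forgetTags (M , M⊆F , regM , noDummy) =
        map proj₂ M , M⊆E , λ s v → trans (∑-map (degAt s v) proj₂ M) (regM s v)
        where
        M⊆E : map proj₂ M ⊆ E
        M⊆E e∈ with ∈-map⁻ proj₂ e∈
        ... | x , x∈M , refl = real∈E (M⊆F x∈M) (∑≡0⇒≡0 isDummy noDummy x∈M)


  perfectMatching : ∀ k E → Regular (suc k) E → Σ (List Pair) λ M → M ⊆ E × Regular 1 M
  perfectMatching k E reg = Padding.matchingOfE k E reg

  module PerfectMatching {M : List Pair} (regM : Regular 1 M) where

    matched : ∀ s v → ∃ λ e → e ∈ M × end s e ≡ v
    matched s v = ∑𝟙≡1⇒∃ (λ x → end s x ≟ᶠ v) M (regM s v)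

    matched-unique : ∀ s {e e′} → e ∈ M → e′ ∈ M → end s e ≡ end s e′ → e ≡ e′
    matched-unique s {e} e∈ e′∈ same = ∑𝟙≡1⇒unique (λ x → end s x ≟ᶠ end s e) M (regM s (end s e)) e∈ refl e′∈ (sym same)

  multiplicity : Pair → List Pair → ℕ
  multiplicity e = ∑ (λ x → 𝟙 (x ≟ₚ e))

  Simple : List Pair → Set
  Simple E = ∀ e → multiplicity e E ≤ 1

  multiplicity-∈ : ∀ {e E} → Simple E → e ∈ E → multiplicity e E ≡ 1
  multiplicity-∈ {e} {E} simple e∈ =
    ≤-antisym (simple e) (subst (_≤ multiplicity e E) (𝟙-yes (e ≟ₚ e) refl) (∈⇒≤∑ (λ x → 𝟙 (x ≟ₚ e)) e∈))

  _without_ : List Pair → List Pair → List Pair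
  E without M = filter (λ x → ¬? (x ∈? M)) E

  without-simple : ∀ E M → Simple E → Simple (E without M)
  without-simple E M simple e =
    ≤-trans (m≤m+n _ _) (≤-trans (≤-reflexive (sym (∑-remove (_∈? M) (λ x → 𝟙 (x ≟ₚ e)) E))) (simple e))

  -- Removing a perfect matching from a simple (k+1)-regular graph leaves a k-regular graph:
  -- at each vertex exactly one removed edge, the matching edge, was incident.
  without-regular : ∀ k E M → Simple E → M ⊆ E → Regular (suc k) E → Regular 1 M →
    Regular k (E without M)
  without-regular k E M simple M⊆E reg regM s v with PerfectMatching.matched {M} regM s v
  ... | e₀ , e₀∈M , e₀-at-v = suc-injective (begin
    suc (∑ (degAt s v) (E without M))                            ≡⟨ +-comm 1 _ ⟩
    ∑ (degAt s v) (E without M) + 1                               ≡⟨ cong (∑ (degAt s v) (E without M) +_) (sym removed) ⟩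
    ∑ (degAt s v) (E without M) + ∑ (λ x → 𝟙 (x ∈? M) * degAt s v x) E
                                                                  ≡⟨ sym (∑-remove (_∈? M) (degAt s v) E) ⟩
    ∑ (degAt s v) E                                               ≡⟨ reg s v ⟩
    suc k                                                         ∎)
    where
    open ≡-Reasoning
    onlyMatchingEdge : ∀ x → 𝟙 (x ∈? M) * degAt s v x ≡ 𝟙 (x ≟ₚ e₀)
    onlyMatchingEdge x with x ∈? M | end s x ≟ᶠ v | x ≟ₚ e₀
    ... | yes x∈M | yes x-at-v | no x≢e₀  =
          ⊥-elim (x≢e₀ (PerfectMatching.matched-unique {M} regM s x∈M e₀∈M (trans x-at-v (sym e₀-at-v))))
    ... | yes _   | yes _      | yes _    = refl
    ... | no x∉M  | _          | yes refl = ⊥-elim (x∉M e₀∈M)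
    ... | no _    | _          | no _     = refl
    ... | yes _   | no x-not-v | yes refl = ⊥-elim (x-not-v e₀-at-v)
    ... | yes _   | no _       | no _     = refl
    removed : ∑ (λ x → 𝟙 (x ∈? M) * degAt s v x) E ≡ 1
    removed = trans (∑-cong E onlyMatchingEdge) (multiplicity-∈ simple (M⊆E e₀∈M))

  record RegularColouring (k : ℕ) (E : List Pair) : Set where
    field
      colour   : Pair → ℕ
      colour<  : ∀ {e} → e ∈ E → colour e < k
      proper   : ∀ s {e e′} → e ∈ E → e′ ∈ E → colour e ≡ colour e′ → end s e ≡ end s e′ → e ≡ e′
      complete : ∀ s v i → i < k → ∃ λ e → e ∈ E × end s e ≡ v × colour e ≡ i

  addMatching : ∀ k E M → M ⊆ E → Regular 1 M →
    RegularColouring k (E without M) → RegularColouring (suc k) E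
  addMatching k E M M⊆E regM rest = record
    { colour = colour ; colour< = colour< ; proper = proper ; complete = complete }
    where
    open PerfectMatching {M} regM
    module Rest = RegularColouring rest

    colourBy : (e : Pair) → Dec (e ∈ M) → ℕ
    colourBy e (yes _) = k
    colourBy e (no _)  = Rest.colour e

    colour : Pair → ℕ
    colour e = colourBy e (e ∈? M)

    colour-M : ∀ {e} → e ∈ M → colour e ≡ k
    colour-M {e} e∈M with e ∈? M
    ... | yes _   = refl
    ... | no e∉M = ⊥-elim (e∉M e∈M)

    colour-rest : ∀ {e} → e ∉ M → colour e ≡ Rest.colour e
    colour-rest {e} e∉M with e ∈? M
    ... | yes e∈M = ⊥-elim (e∉M e∈M)
    ... | no _    = refl

    colour< : ∀ {e} → e ∈ E → colour e < suc k
    colour< {e} e∈ with e ∈? M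
    ... | yes _   = n<1+n k
    ... | no e∉M = m<n⇒m<1+n (Rest.colour< (∈-filter⁺ (λ x → ¬? (x ∈? M)) e∈ e∉M))

    proper : ∀ s {e e′} → e ∈ E → e′ ∈ E → colour e ≡ colour e′ → end s e ≡ end s e′ → e ≡ e′
    proper s {e} {e′} e∈ e′∈ same-colour same-end with e ∈? M | e′ ∈? M
    ... | yes e∈M | yes e′∈M = matched-unique s e∈M e′∈M same-end
    ... | yes _   | no e′∉M =
          ⊥-elim (<-irrefl (sym same-colour) (Rest.colour< (∈-filter⁺ (λ x → ¬? (x ∈? M)) e′∈ e′∉M)))
    ... | no e∉M | yes _    =
          ⊥-elim (<-irrefl same-colour (Rest.colour< (∈-filter⁺ (λ x → ¬? (x ∈? M)) e∈ e∉M)))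
    ... | no e∉M | no e′∉M =
          Rest.proper s (∈-filter⁺ (λ x → ¬? (x ∈? M)) e∈ e∉M) (∈-filter⁺ (λ x → ¬? (x ∈? M)) e′∈ e′∉M)
            same-colour same-end

    complete : ∀ s v i → i < suc k → ∃ λ e → e ∈ E × end s e ≡ v × colour e ≡ i
    complete s v i i≤k with i ≟ k
    ... | yes refl = let (e , e∈M , at-v) = matched s v in e , M⊆E e∈M , at-v , colour-M e∈M
    ... | no i≢k with Rest.complete s v i (≤∧≢⇒< (≤-pred i≤k) i≢k)
    ...   | e , e∈rest , at-v , coloured =
            let (e∈E , e∉M) = ∈-filter⁻ (λ x → ¬? (x ∈? M)) e∈rest
            in e , e∈E , at-v , trans (colour-rest e∉M) coloured

  -- König: a simple k-regular bipartite graph has a proper k-edge-colouring, obtained by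
  -- peeling off perfect matchings.
  könig : ∀ k E → Simple E → Regular k E → RegularColouring k E
  könig zero E _ reg = record
    { colour = λ _ → 0 ; colour< = λ e∈ → ⊥-elim (noEdge e∈)
    ; proper = λ _ e∈ → ⊥-elim (noEdge e∈) ; complete = λ _ _ _ () }
    where
    noEdge : ∀ {e} → e ∈ E → ⊥
    noEdge {e} e∈ = ∑𝟙≡0⇒¬ (λ x → proj₁ x ≟ᶠ proj₁ e) E (reg false (proj₁ e)) e∈ refl
  könig (suc k) E simple reg =
    let (M , M⊆E , regM) = perfectMatching k E reg
    in addMatching k E M M⊆E regM
         (könig k (E without M) (without-simple E M simple) (without-regular k E M simple M⊆E reg regM))

-- The (2r-2, 2r)-biregular case, with r = r′ + 1, X = side false and Y = side true.
module Biregular (r′ : ℕ) (G : Graph) (side : Fin (Graph.n G) → Bool)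
  (bipartite : ∀ u v → Adj G u v → side u ≢ side v)
  (deg-X : ∀ v → side v ≡ false → degree G v ≡ r′ + r′)
  (deg-Y : ∀ v → side v ≡ true → degree G v ≡ suc r′ + suc r′) where

  N : ℕ
  N = Graph.n G

  r : ℕ
  r = suc r′

  open König N
  open Orientation (_≟ᶠ_ {N})
  open import Data.List.Membership.DecPropositional _≟ₚ_ using (_∈?_)

  adj-sym : ∀ {u w} → Adj G u w → Adj G w u
  adj-sym {u} {w} = subst T (Graph.sym G u w)

  opposite : ∀ {u w} → Adj G u w → side w ≡ not (side u)
  opposite {u} {w} uw with side u in su | side w in sw
  ... | false | true  = refl
  ... | true  | false = refl
  ... | false | false = ⊥-elim (bipartite u w uw (trans su (sym sw)))
  ... | true  | true  = ⊥-elim (bipartite u w uw (trans su (sym sw)))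

  -- the edges of G, each listed once, as arcs from X to Y
  ArcXY : Pair → Set
  ArcXY (x , y) = side x ≡ false × Adj G x y

  arcXY? : ∀ p → Dec (ArcXY p)
  arcXY? (x , y) = (side x ≟ᵇ false) ×-dec T? (Graph.adj G x y)

  L : List Pair
  L = filter arcXY? (cartesianProduct (allFin N) (allFin N))

  ∈L : ∀ {x y} → side x ≡ false → Adj G x y → (x , y) ∈ L
  ∈L sx xy = ∈-filter⁺ arcXY? (∈-cartesianProduct⁺ (∈-allFin _) (∈-allFin _)) (sx , xy)

  L-arc : ∀ {l} → l ∈ L → ArcXY l
  L-arc = proj₂ ∘ ∈-filter⁻ arcXY? {xs = cartesianProduct (allFin N) (allFin N)}

  ∑-L : ∀ g → ∑ g L ≡ ∑ (λ x → ∑ (λ y → 𝟙 (arcXY? (x , y)) * g (x , y)) (allFin N)) (allFin N)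
  ∑-L g = trans (∑-filter arcXY? g (cartesianProduct (allFin N) (allFin N)))
    (∑-cartesianProduct (λ p → 𝟙 (arcXY? p) * g p) (allFin N) (allFin N))

  arcXY-asym : ∀ a b → 𝟙 (arcXY? (a , b)) + 𝟙 (arcXY? (b , a)) ≤ 1
  arcXY-asym a b with arcXY? (a , b) | arcXY? (b , a)
  ... | yes (sa , ab) | yes (sb , _) = ⊥-elim (bipartite a b ab (trans sa (sym sb)))
  ... | yes _ | no _  = ≤-refl
  ... | no _  | ba    = 𝟙≤1 ba

  arcs-from : ∀ u → ∑ (tailAt u) L ≡ ∑ (λ y → 𝟙 (arcXY? (u , y))) (allFin N)
  arcs-from u = trans (∑-L (tailAt u)) (trans
    (∑-cong (allFin N) (λ x → ∑-cong (allFin N) (λ y → *-comm (𝟙 (arcXY? (x , y))) (𝟙 (x ≟ᶠ u)))))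
    (∑-δ-row u (λ x y → 𝟙 (arcXY? (x , y))) (allFin N)))

  arcs-into : ∀ u → ∑ (headAt u) L ≡ ∑ (λ x → 𝟙 (arcXY? (x , u))) (allFin N)
  arcs-into u = trans (∑-L (headAt u)) (∑-cong (allFin N) (λ x →
    trans (∑-cong (allFin N) (λ y → *-comm (𝟙 (arcXY? (x , y))) (𝟙 (y ≟ᶠ u))))
          (∑-δ u (λ y → 𝟙 (arcXY? (x , y))))))

  degree-∑ : ∀ u → degree G u ≡ ∑ (λ w → 𝟙 (T? (Graph.adj G u w))) (allFin N)
  degree-∑ u = length-filter (λ w → T? (Graph.adj G u w)) (allFin N)

  deg-L : ∀ u → ∑ (endAt u) L ≡ degree G u
  deg-L u = trans (∑-+ (tailAt u) (headAt u) L)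
    (trans (cong₂ _+_ (arcs-from u) (arcs-into u)) (bySide (side u) refl))
    where
    bySide : ∀ b → side u ≡ b →
      ∑ (λ y → 𝟙 (arcXY? (u , y))) (allFin N) + ∑ (λ x → 𝟙 (arcXY? (x , u))) (allFin N) ≡ degree G u
    bySide false su = begin
      ∑ (λ y → 𝟙 (arcXY? (u , y))) (allFin N) + ∑ (λ x → 𝟙 (arcXY? (x , u))) (allFin N)
        ≡⟨ cong₂ _+_ (∑-cong (allFin N) (λ y → 𝟙-cong (arcXY? (u , y)) (T? _) proj₂ (su ,_)))
                     (∑-zero _ (allFin N) (λ x → 𝟙-no (arcXY? (x , u)) (λ (sx , xu) →
                        bipartite x u xu (trans sx (sym su))))) ⟩
      ∑ (λ y → 𝟙 (T? (Graph.adj G u y))) (allFin N) + 0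
        ≡⟨ trans (+-identityʳ _) (sym (degree-∑ u)) ⟩
      degree G u ∎
      where open ≡-Reasoning
    bySide true su = begin
      ∑ (λ y → 𝟙 (arcXY? (u , y))) (allFin N) + ∑ (λ x → 𝟙 (arcXY? (x , u))) (allFin N)
        ≡⟨ cong₂ _+_ (∑-zero _ (allFin N) (λ y → 𝟙-no (arcXY? (u , y)) (λ (su′ , _) → true≢false (trans (sym su) su′))))
                     (∑-cong (allFin N) (λ x → 𝟙-cong (arcXY? (x , u)) (T? _) (adj-sym ∘ proj₂)
                        (λ ux → trans (opposite ux) (cong not su) , adj-sym ux))) ⟩
      0 + ∑ (λ x → 𝟙 (T? (Graph.adj G u x))) (allFin N)
        ≡⟨ sym (degree-∑ u) ⟩
      degree G u ∎
      where
      open ≡-Reasoning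
      true≢false : true ≢ false
      true≢false ()

  multiplicity-L : ∀ a b → multiplicity (a , b) L ≡ 𝟙 (arcXY? (a , b))
  multiplicity-L a b = begin
    multiplicity (a , b) L
      ≡⟨ ∑-L (λ p → 𝟙 (p ≟ₚ (a , b))) ⟩
    ∑ (λ x → ∑ (λ y → 𝟙 (arcXY? (x , y)) * 𝟙 ((x , y) ≟ₚ (a , b))) (allFin N)) (allFin N)
      ≡⟨ ∑-cong (allFin N) (λ x → ∑-cong (allFin N) (λ y → regroup x y)) ⟩
    ∑ (λ x → ∑ (λ y → 𝟙 (x ≟ᶠ a) * (𝟙 (y ≟ᶠ b) * 𝟙 (arcXY? (x , y)))) (allFin N)) (allFin N)
      ≡⟨ ∑-δ-row a (λ x y → 𝟙 (y ≟ᶠ b) * 𝟙 (arcXY? (x , y))) (allFin N) ⟩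
    ∑ (λ y → 𝟙 (y ≟ᶠ b) * 𝟙 (arcXY? (a , y))) (allFin N)
      ≡⟨ ∑-δ b (λ y → 𝟙 (arcXY? (a , y))) ⟩
    𝟙 (arcXY? (a , b)) ∎
    where
    open ≡-Reasoning
    regroup : ∀ x y → 𝟙 (arcXY? (x , y)) * 𝟙 ((x , y) ≟ₚ (a , b)) ≡ 𝟙 (x ≟ᶠ a) * (𝟙 (y ≟ᶠ b) * 𝟙 (arcXY? (x , y)))
    regroup x y = trans (cong (𝟙 (arcXY? (x , y)) *_) (𝟙-pair ((x , y) ≟ₚ (a , b)) (x ≟ᶠ a) (y ≟ᶠ b)))
      (rearrange (𝟙 (arcXY? (x , y))) (𝟙 (x ≟ᶠ a)) (𝟙 (y ≟ᶠ b)))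
      where
      rearrange : ∀ p q s → p * (q * s) ≡ q * (s * p)
      rearrange = solve-∀

  -- Both degrees are even, 2r′ on X and 2r on Y: record the half degree d and the fact that
  -- d plus the number of loops to be added at v (one on X, none on Y) is r.
  degree-halved : ∀ v → Σ ℕ λ d → degree G v ≡ d + d × d + 𝟙 (side v ≟ᵇ false) ≡ r
  degree-halved v with side v in sv
  ... | false = r′ , deg-X v sv , +-comm r′ 1
  ... | true  = r  , deg-Y v sv , +-identityʳ r

  even : EvenDegrees L
  even v = let (d , deg≡ , _) = degree-halved v in subst (2 ∣_) (sym (trans (deg-L v) deg≡)) (2∣m+m d)

  -- Only the stated properties of the orientation and of the colouring below are used; they
  -- are kept opaque so that the type checker never unfolds their construction.
  opaque
    orientation : BalancedOrientation L
    orientation = euler L even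

  O : List Pair
  O = proj₁ orientation

  O-orients : Pointwise _⇝_ L O
  O-orients = proj₁ (proj₂ orientation)

  O-balanced : Balanced O
  O-balanced = proj₂ (proj₂ orientation)

  O-half : ∀ s v → ∑ (degAt s v) O ≡ proj₁ (degree-halved v)
  O-half false v = +-double-injective _ d (begin
    ∑ (tailAt v) O + ∑ (tailAt v) O  ≡⟨ cong (∑ (tailAt v) O +_) (O-balanced v) ⟩
    ∑ (tailAt v) O + ∑ (headAt v) O  ≡⟨ sym (∑-+ (tailAt v) (headAt v) O) ⟩
    ∑ (endAt v) O                    ≡⟨ ∑-reorient (endAt v) (endAt-swap v) O-orients ⟩
    ∑ (endAt v) L                    ≡⟨ deg-L v ⟩
    degree G v                       ≡⟨ proj₁ (proj₂ (degree-halved v)) ⟩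
    d + d                            ∎)
    where
    open ≡-Reasoning
    d : ℕ
    d = proj₁ (degree-halved v)
  O-half true v = trans (sym (O-balanced v)) (O-half false v)

  D : List Pair
  D = map (λ x → x , x) (filter (λ x → side x ≟ᵇ false) (allFin N))

  ∑-D : ∀ g → ∑ g D ≡ ∑ (λ x → 𝟙 (side x ≟ᵇ false) * g (x , x)) (allFin N)
  ∑-D g = trans (∑-map g (λ x → x , x) (filter (λ x → side x ≟ᵇ false) (allFin N))) (∑-filter (λ x → side x ≟ᵇ false) (λ x → g (x , x)) (allFin N))

  D-degree : ∀ s v → ∑ (degAt s v) D ≡ 𝟙 (side v ≟ᵇ false)
  D-degree s v = trans (∑-D (degAt s v)) (trans
    (∑-cong (allFin N) (λ x → trans (cong (λ y → 𝟙 (side x ≟ᵇ false) * 𝟙 (y ≟ᶠ v)) (end-diagonal s x))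
                                    (*-comm (𝟙 (side x ≟ᵇ false)) (𝟙 (x ≟ᶠ v)))))
    (∑-δ v (λ x → 𝟙 (side x ≟ᵇ false))))

  -- The auxiliary bipartite graph: the arcs of O together with the loops on X.  It is
  -- r-regular and simple, hence has a proper r-edge-colouring by König's theorem.
  B : List Pair
  B = O ++ D

  B-regular : Regular r B
  B-regular s v = begin
    ∑ (degAt s v) (O ++ D)                 ≡⟨ ∑-++ (degAt s v) O D ⟩
    ∑ (degAt s v) O + ∑ (degAt s v) D      ≡⟨ cong₂ _+_ (O-half s v) (D-degree s v) ⟩
    proj₁ (degree-halved v) + 𝟙 (side v ≟ᵇ false) ≡⟨ proj₂ (proj₂ (degree-halved v)) ⟩
    r                                      ∎
    where open ≡-Reasoning

  O-pair : ∀ a b → multiplicity (a , b) O + multiplicity (b , a) O ≤ 1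
  O-pair a b = begin
    multiplicity (a , b) O + multiplicity (b , a) O    ≡⟨ sym (∑-+ δab δba O) ⟩
    ∑ (λ p → δab p + δba p) O                          ≡⟨ ∑-reorient (λ p → δab p + δba p) swap-invariant O-orients ⟩
    ∑ (λ p → δab p + δba p) L                          ≡⟨ ∑-+ δab δba L ⟩
    multiplicity (a , b) L + multiplicity (b , a) L    ≡⟨ cong₂ _+_ (multiplicity-L a b) (multiplicity-L b a) ⟩
    𝟙 (arcXY? (a , b)) + 𝟙 (arcXY? (b , a))            ≤⟨ arcXY-asym a b ⟩
    1                                                  ∎
    where
    open ≤-Reasoning
    δab δba : Pair → ℕ
    δab p = 𝟙 (p ≟ₚ (a , b))
    δba p = 𝟙 (p ≟ₚ (b , a))
    swap-invariant : ∀ p → δab (swap p) + δba (swap p) ≡ δab p + δba p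
    swap-invariant p = trans (cong₂ _+_ (𝟙-cong (swap p ≟ₚ (a , b)) (p ≟ₚ (b , a)) (cong swap) (cong swap))
                                        (𝟙-cong (swap p ≟ₚ (b , a)) (p ≟ₚ (a , b)) (cong swap) (cong swap)))
                             (+-comm (δba p) (δab p))

  D-loop : ∀ a → multiplicity (a , a) D ≤ 1
  D-loop a = begin
    multiplicity (a , a) D                                               ≡⟨ ∑-D (λ p → 𝟙 (p ≟ₚ (a , a))) ⟩
    ∑ (λ x → 𝟙 (side x ≟ᵇ false) * 𝟙 ((x , x) ≟ₚ (a , a))) (allFin N)   ≤⟨ ∑-mono (allFin N) atMostDiagonal ⟩
    ∑ (λ x → 𝟙 (x ≟ᶠ a) * 1) (allFin N)                                 ≡⟨ ∑-δ a (λ _ → 1) ⟩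
    1                                                                    ∎
    where
    open ≤-Reasoning
    atMostDiagonal : ∀ x → 𝟙 (side x ≟ᵇ false) * 𝟙 ((x , x) ≟ₚ (a , a)) ≤ 𝟙 (x ≟ᶠ a) * 1
    atMostDiagonal x = ≤-trans (𝟙*≤ (side x ≟ᵇ false) _)
      (≤-reflexive (trans (𝟙-cong ((x , x) ≟ₚ (a , a)) (x ≟ᶠ a) (cong proj₁) (λ x≡a → cong₂ _,_ x≡a x≡a))
                          (sym (*-identityʳ _))))

  D-nonloop : ∀ {a b} → a ≢ b → multiplicity (a , b) D ≡ 0
  D-nonloop {a} {b} a≢b = trans (∑-D (λ p → 𝟙 (p ≟ₚ (a , b)))) (∑-zero _ (allFin N) (λ x →
    trans (cong (𝟙 (side x ≟ᵇ false) *_) (𝟙-no ((x , x) ≟ₚ (a , b)) (λ eq → a≢b (trans (sym (cong proj₁ eq)) (cong proj₂ eq)))))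
          (*-zeroʳ (𝟙 (side x ≟ᵇ false)))))

  B-simple : Simple B
  B-simple (a , b) = subst (_≤ 1) (sym (∑-++ (λ p → 𝟙 (p ≟ₚ (a , b))) O D)) (bySameEnds (a ≟ᶠ b))
    where
    bySameEnds : Dec (a ≡ b) → multiplicity (a , b) O + multiplicity (a , b) D ≤ 1
    bySameEnds (yes refl) = subst (λ m → m + multiplicity (a , a) D ≤ 1)
                              (sym (+-double≤1 _ (O-pair a a))) (D-loop a)
    bySameEnds (no a≢b) = subst (λ m → multiplicity (a , b) O + m ≤ 1) (sym (D-nonloop a≢b))
                            (≤-trans (≤-reflexive (+-identityʳ _)) (≤-trans (m≤m+n _ _) (O-pair a b)))

  opaque
    κ : RegularColouring r B
    κ = könig r B B-simple B-regular

  open RegularColouring κ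

  inB : ∀ {a} → a ∈ O → a ∈ B
  inB = ∈-++⁺ˡ

  O-adj : ∀ {a} → a ∈ O → Adj G (proj₁ a) (proj₂ a)
  O-adj a∈ with Pointwise-∈ʳ a∈ O-orients
  ... | l , l∈L , inj₁ refl = proj₂ (L-arc l∈L)
  ... | l , l∈L , inj₂ refl = adj-sym (proj₂ (L-arc l∈L))

  O-loopless : ∀ {v} → (v , v) ∉ O
  O-loopless {v} vv∈ = subst T (Graph.irrefl G v) (O-adj vv∈)

  O-one-way : ∀ {u w} → (u , w) ∈ O → (w , u) ∉ O
  O-one-way {u} {w} uw∈ wu∈ = <-irrefl refl (begin-strict
    1      <⟨ s≤s (≤-refl {1}) ⟩
    1 + 1  ≤⟨ +-mono-≤ (occurs uw∈) (occurs wu∈) ⟩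
    multiplicity (u , w) O + multiplicity (w , u) O ≤⟨ O-pair u w ⟩
    1      ∎)
    where
    open ≤-Reasoning
    occurs : ∀ {p} → p ∈ O → 1 ≤ multiplicity p O
    occurs {p} p∈ = subst (_≤ multiplicity p O) (𝟙-yes (p ≟ₚ p) refl) (∈⇒≤∑ (λ x → 𝟙 (x ≟ₚ p)) p∈)

  L-oriented : ∀ {x y} → (x , y) ∈ L → (x , y) ∈ O ⊎ (y , x) ∈ O
  L-oriented xy∈ with Pointwise-∈ˡ xy∈ O-orients
  ... | _ , o∈ , inj₁ refl = inj₁ o∈
  ... | _ , o∈ , inj₂ refl = inj₂ o∈

  O-some-way : ∀ {u w} → Adj G u w → (u , w) ∈ O ⊎ (w , u) ∈ O
  O-some-way {u} {w} uw with side u in su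
  ... | false = L-oriented (∈L su uw)
  ... | true  = swap⊎ (L-oriented (∈L (trans (opposite uw) (cong not su)) (adj-sym uw)))

  -- The edge colouring of G: an edge carried by the arc a of O gets colour 2·colour(a) plus 1
  -- exactly when a starts in Y.  So at a vertex v the arcs leaving v give colours of one
  -- parity and the arcs entering v colours of the other, each parity class using every colour
  -- of the r-colouring except that of the loop at v.
  arcBy : (u w : Fin N) → Dec ((u , w) ∈ O) → Pair
  arcBy u w (yes _) = u , w
  arcBy u w (no _)  = w , u

  arcOf : Fin N → Fin N → Pair
  arcOf u w = arcBy u w ((u , w) ∈? O)

  arcOf-forward : ∀ {u w} → (u , w) ∈ O → arcOf u w ≡ (u , w)
  arcOf-forward {u} {w} uw∈ with (u , w) ∈? O
  ... | yes _    = refl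
  ... | no uw∉ = ⊥-elim (uw∉ uw∈)

  arcOf-backward : ∀ {u w} → (w , u) ∈ O → arcOf u w ≡ (w , u)
  arcOf-backward {u} {w} wu∈ with (u , w) ∈? O
  ... | yes uw∈ = ⊥-elim (O-one-way uw∈ wu∈)
  ... | no _    = refl

  arcOf-ends : ∀ {u w} → Adj G u w → ∃ λ s → arcOf u w ∈ O × end s (arcOf u w) ≡ u × end (not s) (arcOf u w) ≡ w
  arcOf-ends uw with O-some-way uw
  ... | inj₁ uw∈ rewrite arcOf-forward uw∈ = false , uw∈ , refl , refl
  ... | inj₂ wu∈ rewrite arcOf-backward wu∈ = true , wu∈ , refl , refl

  arcOf-sym : ∀ {u w} → Adj G u w → arcOf u w ≡ arcOf w u
  arcOf-sym uw with O-some-way uw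
  ... | inj₁ uw∈ = trans (arcOf-forward uw∈) (sym (arcOf-backward uw∈))
  ... | inj₂ wu∈ = trans (arcOf-backward wu∈) (sym (arcOf-forward wu∈))

  arc-at : ∀ s {a v} → a ∈ O → end s a ≡ v → Adj G v (end (not s) a) × arcOf v (end (not s) a) ≡ a
  arc-at false {v , w} a∈ refl = O-adj a∈ , arcOf-forward a∈
  arc-at true  {w , v} a∈ refl = adj-sym (O-adj a∈) , arcOf-backward a∈

  tail-side : ∀ s {a v} → a ∈ O → end s a ≡ v → side (proj₁ a) ≡ s xor side v
  tail-side false {v , w} a∈ refl = refl
  tail-side true  {w , v} a∈ refl = opposite (adj-sym (O-adj a∈))

  arcColour : Pair → ℕ
  arcColour a = 2 * colour a + bit (side (proj₁ a))

  edgeColour : Fin N → Fin N → ℕ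
  edgeColour u w = arcColour (arcOf u w)

  edgeColour-sym : ∀ u w → Adj G u w → edgeColour u w ≡ edgeColour w u
  edgeColour-sym u w uw = cong arcColour (arcOf-sym uw)

  -- two edges at v with the same colour have v at the same end of their arcs and the same
  -- colour in B, so they coincide by properness of the König colouring
  edgeColour-proper : ∀ v u w → Adj G v u → Adj G v w → u ≢ w → edgeColour v u ≢ edgeColour v w
  edgeColour-proper v u w vu vw u≢w same with arcOf-ends vu | arcOf-ends vw
  ... | s , a∈ , a-at-v , a-at-u | s′ , a′∈ , a′-at-v , a′-at-w =
    u≢w (sameEnd s′ s≡s′ a′-at-v a′-at-w)
    where
    a a′ : Pair
    a  = arcOf v u
    a′ = arcOf v w
    split : colour a ≡ colour a′ × side (proj₁ a) ≡ side (proj₁ a′)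
    split = 2*+bit-injective (colour a) (colour a′) (side (proj₁ a)) (side (proj₁ a′)) same
    s≡s′ : s ≡ s′
    s≡s′ = begin
      s                         ≡⟨ sym (xor-cancelʳ s (side v)) ⟩
      (s xor side v) xor side v ≡⟨ cong (_xor side v) (sym (tail-side s a∈ a-at-v)) ⟩
      side (proj₁ a) xor side v ≡⟨ cong (_xor side v) (proj₂ split) ⟩
      side (proj₁ a′) xor side v ≡⟨ cong (_xor side v) (tail-side s′ a′∈ a′-at-v) ⟩
      (s′ xor side v) xor side v ≡⟨ xor-cancelʳ s′ (side v) ⟩
      s′                        ∎
      where open ≡-Reasoning
    sameEnd : ∀ t → s ≡ t → end t a′ ≡ v → end (not t) a′ ≡ w → u ≡ w
    sameEnd _ refl a′-v a′-w = begin
      u                ≡⟨ sym a-at-u ⟩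
      end (not s) a    ≡⟨ cong (end (not s)) (proper s (inB a∈) (inB a′∈) (proj₁ split) (trans a-at-v (sym a′-v))) ⟩
      end (not s) a′   ≡⟨ a′-w ⟩
      w                ∎
      where open ≡-Reasoning

  -- The colour of the loop at v (if v ∈ X) is the one colour of B missing at v in O.
  Missing : Fin N → ℕ → Set
  Missing v i = (v , v) ∈ B × colour (v , v) ≡ i

  colours-at⁺ : ∀ s v i → (∃ λ a → a ∈ O × end s a ≡ v × colour a ≡ i) → i < r × ¬ Missing v i
  colours-at⁺ s v i (a , a∈ , at-v , coloured) =
    subst (_< r) coloured (colour< (inB a∈)) ,
    λ (loop∈ , loop-coloured) → O-loopless (subst (_∈ O)
      (proper s (inB a∈) loop∈ (trans coloured (sym loop-coloured)) (trans at-v (sym (end-diagonal s v)))) a∈)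

  colours-at⁻ : ∀ s v i → i < r → ¬ Missing v i → ∃ λ a → a ∈ O × end s a ≡ v × colour a ≡ i
  colours-at⁻ s v i i<r notMissing with complete s v i i<r
  ... | e , e∈B , at-v , coloured with ∈-++⁻ O e∈B
  ...   | inj₁ e∈O = e , e∈O , at-v , coloured
  ...   | inj₂ e∈D with ∈-map⁻ (λ x → x , x) e∈D
  ...     | x , _ , refl rewrite end-diagonal s x with at-v
  ...       | refl = ⊥-elim (notMissing (e∈B , coloured))

  -- Each vertex gets a label: zero on Y, and 1 + (colour of the loop) on X.
  labelBy : (v : Fin N) → Dec ((v , v) ∈ B) → Fin (suc r)
  labelBy v (yes loop∈) = fsuc (fromℕ< (colour< loop∈))
  labelBy v (no _)      = fzero

  label : Fin N → Fin (suc r)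
  label v = labelBy v ((v , v) ∈? B)

  label-missing : ∀ v i → toℕ (label v) ≡ suc i → Missing v i
  label-missing v i eq with (v , v) ∈? B
  ... | yes loop∈ = loop∈ , trans (sym (toℕ-fromℕ< (colour< loop∈))) (suc-injective eq)

  missing-label : ∀ v i → Missing v i → toℕ (label v) ≡ suc i
  missing-label v i (loop∈ , coloured) with (v , v) ∈? B
  ... | yes loop∈′ = cong suc (trans (toℕ-fromℕ< (colour< loop∈′)) coloured)
  ... | no loop∉   = ⊥-elim (loop∉ loop∈)

  -- The palette determined by a label: all 2i + b with i < r, except 2d and 2d + 1 when the
  -- label is 1 + d.  There are r + 1 labels, hence at most r + 1 palettes.
  Palette : Fin (suc r) → ℕ → Set
  Palette ℓ k = ∃ λ i → ∃ λ b → k ≡ 2 * i + bit b × i < r × toℕ ℓ ≢ suc i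

  palette⁺ : ∀ v k → InPalette G edgeColour v k → Palette (label v) k
  palette⁺ v k (w , vw , refl) with arcOf-ends vw
  ... | s , a∈ , at-v , _ =
    let (i<r , notMissing) = colours-at⁺ s v (colour (arcOf v w)) (arcOf v w , a∈ , at-v , refl)
    in colour (arcOf v w) , s xor side v , cong (λ b → 2 * colour (arcOf v w) + bit b) (tail-side s a∈ at-v) ,
       i<r , λ eq → notMissing (label-missing v _ eq)

  palette⁻ : ∀ v k → Palette (label v) k → InPalette G edgeColour v k
  palette⁻ v k (i , b , refl , i<r , notLabel)
    with colours-at⁻ (b xor side v) v i i<r (λ m → notLabel (missing-label v i m))
  ... | a , a∈ , at-v , coloured =
    let s = b xor side v
        (vw , arcOf≡a) = arc-at s a∈ at-v
    in end (not s) a , vw , (begin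
      arcColour (arcOf v (end (not s) a))       ≡⟨ cong arcColour arcOf≡a ⟩
      2 * colour a + bit (side (proj₁ a))       ≡⟨ cong₂ (λ c d → 2 * c + bit d) coloured (tail-side s a∈ at-v) ⟩
      2 * i + bit ((b xor side v) xor side v)   ≡⟨ cong (λ d → 2 * i + bit d) (xor-cancelʳ b (side v)) ⟩
      2 * i + bit b                             ∎)
    where open ≡-Reasoning

  samePalette : ∀ v w → label v ≡ label w → SamePalette G edgeColour v w
  samePalette v w same k = mk⇔
    (λ p → palette⁻ w k (subst (λ ℓ → Palette ℓ k) same (palette⁺ v k p)))
    (λ p → palette⁻ v k (subst (λ ℓ → Palette ℓ k) (sym same) (palette⁺ w k p)))

  paletteIndex : PaletteIndex≤ G (suc r)
  paletteIndex = edgeColour , (edgeColour-sym , edgeColour-proper) , label , samePalette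

corollary4p5 : (r : ℕ) → 1 ≤ r → (G : Graph) → IsBiregular (2 * r ∸ 2) (2 * r) G →
    PaletteIndex≤ G (suc r)
corollary4p5 zero     () G _
corollary4p5 (suc r′) _ G (side , bipartite , deg-X , deg-Y) =
  Biregular.paletteIndex r′ G side bipartite
    (λ v sv → trans (deg-X v sv) 2r-2≡r′+r′)
    (λ v sv → trans (deg-Y v sv) (2*m≡m+m (suc r′)))
  where
  2*m≡m+m : ∀ m → 2 * m ≡ m + m
  2*m≡m+m = solve-∀
  2*suc≡2+m+m : ∀ m → 2 * suc m ≡ 2 + (m + m)
  2*suc≡2+m+m = solve-∀
  2r-2≡r′+r′ : 2 * suc r′ ∸ 2 ≡ r′ + r′
  2r-2≡r′+r′ = cong (_∸ 2) (2*suc≡2+m+m r′)
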